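{- Let $\alpha\in\{FD,\ DF\}$. For every $n\geq 0$, the number of $\alpha$-equivalence classes of the set $\mathcal{L}_n$ of Łukasiewicz paths of length $n$ is $f_n$, where $f_0=f_1=f_2=1$ and $f_n=f_{n-1}+f_{n-2}$ for $n\geq 3$.
   Context: A Łukasiewicz path of length $n$ is a sequence of $n$ steps from $\{(1,i): i\geq -1\}$ starting at $(0,0)$, ending at $(n,0)$ and never going below the $x$-axis. Write $D=(1,-1)$, $F=(1,0)$, $U_i=(1,i)$ for $i\geq1$. Steps are numbered $1,\dots,n$; an occurrence of a two-step pattern is at position $i$ if its first step is the $i$-th step. Two paths of the same length are $\alpha$-equivalent if the sets of occurrence positions of $\alpha$ in them are identical. -}

module Defs where

open import Data.Nat using (ℕ; zero; suc; _+_)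
open import Data.List using (List; []; _∷_; length)
open import Data.Maybe using (Maybe; just; nothing)
open import Data.Product using (Σ; _×_; _,_; proj₁)
open import Relation.Binary.PropositionalEquality using (_≡_)
open import Function.Bundles using (_⇔_)

-- Steps of a Łukasiewicz path: D = (1,-1), F = (1,0), U i = (1, i+1)  (so U i encodes U_{i+1}).
data Step : Set where
  D : Step
  F : Step
  U : ℕ → Step

-- Valid h xs : the step sequence xs, started at height h, never goes below the x-axis
-- and ends at height 0.
data Valid : ℕ → List Step → Set where
  nil  : Valid 0 []
  stepD : ∀ {h xs} → Valid h xs → Valid (suc h) (D ∷ xs)
  stepF : ∀ {h xs} → Valid h xs → Valid h (F ∷ xs)
  stepU : ∀ {h xs} (i : ℕ) → Valid (h + suc i) xs → Valid h (U i ∷ xs)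

LukPath : ℕ → Set
LukPath n = Σ (List Step) (λ xs → (length xs ≡ n) × Valid 0 xs)

data Pattern : Set where
  FD DF : Pattern

fst snd : Pattern → Step
fst FD = F
fst DF = D
snd FD = D
snd DF = F

_‼_ : List Step → ℕ → Maybe Step
[] ‼ _ = nothing
(x ∷ xs) ‼ zero = just x
(x ∷ xs) ‼ suc i = xs ‼ i

-- α occurs at (0-based) position i: step i is the first letter, step i+1 the second.
OccursAt : Pattern → List Step → ℕ → Set
OccursAt α xs i = (xs ‼ i ≡ just (fst α)) × (xs ‼ suc i ≡ just (snd α))

_≈[_]_ : ∀ {n} → LukPath n → Pattern → LukPath n → Set
p ≈[ α ] q = ∀ (i : ℕ) → OccursAt α (proj₁ p) i ⇔ OccursAt α (proj₁ q) i

f : ℕ → ℕ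
f 0 = 1
f 1 = 1
f 2 = 1
f (suc (suc (suc n))) = f (suc (suc n)) + f (suc n)

-- Two paths of the same length are α-equivalent iff they have the same occurrence word
-- (bit i records whether α occurs at i). Occurrences of FD or DF never overlap and none
-- starts at the last step, so any occurrence word is a monomino–domino tiling word
-- (blocks 0 and 10); for a Łukasiewicz path its first bit is moreover 0, since the path
-- cannot start with D or with FD. Conversely a tiling of n - 1 cells with d dominoes is
-- realised by the path U_d (or F if d = 0) followed by F for each monomino and α for each
-- domino. So the classes correspond to tilings of n - 1 cells, of which there are f n.
module Submission where

open import Defs
open import Data.Bool using (Bool; true; false)
open import Data.Fin using (Fin)
open import Data.Fin.Properties using (1↔⊤; +↔⊎)
open import Data.List using (List; []; _∷_; length)
open import Data.List.Properties using (∷-injectiveˡ; ∷-injectiveʳ)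
open import Data.Maybe using (just)
open import Data.Maybe.Properties using (just-injective) renaming (≡-dec to ≡-decᴹ)
open import Data.Nat using (ℕ; zero; suc; _≟_)
open import Data.Nat.Properties using (suc-injective)
open import Data.Product using (Σ; _×_; ∃; _,_; proj₁; proj₂)
open import Data.Sum using (_⊎_; inj₁; inj₂)
open import Data.Sum.Function.Propositional using (_⊎-cong_)
open import Data.Unit using (⊤; tt)
open import Function using (_∘_; id)
open import Function.Bundles using (_⇔_; mk⇔; _↔_; mk↔ₛ′; Inverse; Equivalence; Injection)
open import Function.Construct.Composition using (_⇔-∘_)
open import Function.Properties.Inverse using (↔-trans; ↔-sym; ↔⇒↣)
open import Relation.Binary.Definitions using (DecidableEquality)
open import Relation.Binary.PropositionalEquality
  using (_≡_; _≢_; refl; sym; trans; cong; cong₂; module ≡-Reasoning)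
open import Relation.Nullary using (¬_; Dec; yes; no; does; contradiction)
open import Relation.Nullary.Decidable using (map′; _×-dec_; dec-true; dec-false)

U-injective : ∀ {i j} → U i ≡ U j → i ≡ j
U-injective refl = refl

_≟ₛ_ : DecidableEquality Step
D ≟ₛ D = yes refl
D ≟ₛ F = no λ ()
D ≟ₛ U _ = no λ ()
F ≟ₛ D = no λ ()
F ≟ₛ F = yes refl
F ≟ₛ U _ = no λ ()
U _ ≟ₛ D = no λ ()
U _ ≟ₛ F = no λ ()
U i ≟ₛ U j = map′ (cong U) U-injective (i ≟ j)

occursAt? : ∀ α xs i → Dec (OccursAt α xs i)
occursAt? α xs i = ≡-decᴹ _≟ₛ_ (xs ‼ i) (just (fst α)) ×-dec ≡-decᴹ _≟ₛ_ (xs ‼ suc i) (just (snd α))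

fst≢snd : ∀ α → fst α ≢ snd α
fst≢snd FD ()
fst≢snd DF ()

occursAt⇒¬occursAt-suc : ∀ α xs i → OccursAt α xs i → ¬ OccursAt α xs (suc i)
occursAt⇒¬occursAt-suc α xs i (_ , second) (first , _) =
  fst≢snd α (just-injective (trans (sym first) second))

¬occursAt-start : ∀ α {xs} → Valid 0 xs → ¬ OccursAt α xs 0
¬occursAt-start α {[]}        _ (() , _)
¬occursAt-start α {_ ∷ []}    _ (_ , ())
¬occursAt-start α {_ ∷ _ ∷ _} v (e₁ , e₂) with just-injective e₁ | just-injective e₂
¬occursAt-start FD (stepF ()) _ | refl | refl
¬occursAt-start DF ()         _ | refl | refl

does≡⇔ : {A B : Set} (a? : Dec A) (b? : Dec B) → (does a? ≡ does b?) ⇔ (A ⇔ B)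
does≡⇔ (yes a) (yes b) = mk⇔ (λ _ → mk⇔ (λ _ → b) (λ _ → a)) (λ _ → refl)
does≡⇔ (no ¬a) (no ¬b) = mk⇔ (λ _ → mk⇔ (λ a → contradiction a ¬a) (λ b → contradiction b ¬b)) (λ _ → refl)
does≡⇔ (yes a) (no ¬b) = mk⇔ (λ ()) (λ a⇔b → contradiction (Equivalence.to a⇔b a) ¬b)
does≡⇔ (no ¬a) (yes b) = mk⇔ (λ ()) (λ a⇔b → contradiction (Equivalence.from a⇔b b) ¬a)

occurrenceWord : Pattern → List Step → List Bool
occurrenceWord α [] = []
occurrenceWord α (x ∷ xs) = does (occursAt? α (x ∷ xs) 0) ∷ occurrenceWord α xs

occurrenceWord≡⇔ : ∀ α xs ys → length xs ≡ length ys →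
  (occurrenceWord α xs ≡ occurrenceWord α ys) ⇔ (∀ i → OccursAt α xs i ⇔ OccursAt α ys i)
occurrenceWord≡⇔ α [] [] _ = mk⇔ (λ _ _ → mk⇔ id id) (λ _ → refl)
occurrenceWord≡⇔ α (x ∷ xs) (y ∷ ys) |xs|≡|ys| = mk⇔ to from
  where
  atHead : (does (occursAt? α (x ∷ xs) 0) ≡ does (occursAt? α (y ∷ ys) 0)) ⇔
           (OccursAt α (x ∷ xs) 0 ⇔ OccursAt α (y ∷ ys) 0)
  atHead = does≡⇔ (occursAt? α (x ∷ xs) 0) (occursAt? α (y ∷ ys) 0)
  inTail : (occurrenceWord α xs ≡ occurrenceWord α ys) ⇔ (∀ i → OccursAt α xs i ⇔ OccursAt α ys i)
  inTail = occurrenceWord≡⇔ α xs ys (suc-injective |xs|≡|ys|)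

  to : occurrenceWord α (x ∷ xs) ≡ occurrenceWord α (y ∷ ys) →
       ∀ i → OccursAt α (x ∷ xs) i ⇔ OccursAt α (y ∷ ys) i
  to eq zero    = Equivalence.to atHead (∷-injectiveˡ eq)
  to eq (suc i) = Equivalence.to inTail (∷-injectiveʳ eq) i

  from : (∀ i → OccursAt α (x ∷ xs) i ⇔ OccursAt α (y ∷ ys) i) →
         occurrenceWord α (x ∷ xs) ≡ occurrenceWord α (y ∷ ys)
  from h = cong₂ _∷_ (Equivalence.from atHead (h 0)) (Equivalence.from inTail (h ∘ suc))

data Tiling : ℕ → Set where
  ∅      : Tiling 0
  mono   : ∀ {m} → Tiling m → Tiling (suc m)
  domino : ∀ {m} → Tiling m → Tiling (suc (suc m))

Tiling₀↔⊤ : Tiling 0 ↔ ⊤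
Tiling₀↔⊤ = mk↔ₛ′ (λ _ → tt) (λ _ → ∅) (λ _ → refl) (λ { ∅ → refl })

Tiling₁↔⊤ : Tiling 1 ↔ ⊤
Tiling₁↔⊤ = mk↔ₛ′ (λ _ → tt) (λ _ → mono ∅) (λ _ → refl) (λ { (mono ∅) → refl })

Tiling-split : ∀ {m} → Tiling (suc (suc m)) ↔ (Tiling (suc m) ⊎ Tiling m)
Tiling-split = mk↔ₛ′ split join (λ { (inj₁ _) → refl ; (inj₂ _) → refl })
                                 (λ { (mono _) → refl ; (domino _) → refl })
  where
  split : ∀ {m} → Tiling (suc (suc m)) → Tiling (suc m) ⊎ Tiling m
  split (mono t)   = inj₁ t
  split (domino t) = inj₂ t
  join : ∀ {m} → Tiling (suc m) ⊎ Tiling m → Tiling (suc (suc m))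
  join (inj₁ t) = mono t
  join (inj₂ t) = domino t

Tiling↔Fin : ∀ m → Tiling m ↔ Fin (f (suc m))
Tiling↔Fin zero          = ↔-trans Tiling₀↔⊤ (↔-sym 1↔⊤)
Tiling↔Fin (suc zero)    = ↔-trans Tiling₁↔⊤ (↔-sym 1↔⊤)
Tiling↔Fin (suc (suc m)) =
  ↔-trans Tiling-split (↔-trans (Tiling↔Fin (suc m) ⊎-cong Tiling↔Fin m) (↔-sym +↔⊎))

tilingWord : ∀ {m} → Tiling m → List Bool
tilingWord ∅          = []
tilingWord (mono t)   = false ∷ tilingWord t
tilingWord (domino t) = true ∷ false ∷ tilingWord t

tilingWord-injective : ∀ {m} {s t : Tiling m} → tilingWord s ≡ tilingWord t → s ≡ t
tilingWord-injective {s = ∅}        {∅}        _  = refl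
tilingWord-injective {s = mono s}   {mono t}   eq = cong mono (tilingWord-injective (∷-injectiveʳ eq))
tilingWord-injective {s = domino s} {domino t} eq =
  cong domino (tilingWord-injective (∷-injectiveʳ (∷-injectiveʳ eq)))
tilingWord-injective {s = mono _}   {domino _} ()
tilingWord-injective {s = domino _} {mono _}   ()

occurrenceWord-tiling : ∀ α xs → Σ (Tiling (length xs)) (λ t → occurrenceWord α xs ≡ tilingWord t)
occurrenceWord-tiling α [] = ∅ , refl
occurrenceWord-tiling α (x ∷ []) =
  mono ∅ , cong (_∷ []) (dec-false (occursAt? α (x ∷ []) 0) λ { (_ , ()) })
occurrenceWord-tiling α (x ∷ y ∷ ys)
  with occursAt? α (x ∷ y ∷ ys) 0 | occurrenceWord-tiling α (y ∷ ys) | occurrenceWord-tiling α ys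
... | no ¬o | t , eq | _ = mono t , cong₂ _∷_ (dec-false (occursAt? α (x ∷ y ∷ ys) 0) ¬o) eq
... | yes o | _ | t , eq =
  domino t , cong₂ _∷_ (dec-true (occursAt? α (x ∷ y ∷ ys) 0) o)
                       (cong₂ _∷_ (dec-false (occursAt? α (y ∷ ys) 0)
                                             (occursAt⇒¬occursAt-suc α (x ∷ y ∷ ys) 0 o))
                                  eq)

dominoes : ∀ {m} → Tiling m → ℕ
dominoes ∅          = 0
dominoes (mono t)   = dominoes t
dominoes (domino t) = suc (dominoes t)

tilingPath : Pattern → ∀ {m} → Tiling m → List Step
tilingPath α ∅          = []
tilingPath α (mono t)   = F ∷ tilingPath α t
tilingPath α (domino t) = fst α ∷ snd α ∷ tilingPath α t

length-tilingPath : ∀ α {m} (t : Tiling m) → length (tilingPath α t) ≡ m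
length-tilingPath α ∅          = refl
length-tilingPath α (mono t)   = cong suc (length-tilingPath α t)
length-tilingPath α (domino t) = cong (suc ∘ suc) (length-tilingPath α t)

valid-fst-snd : ∀ α {h xs} → Valid h xs → Valid (suc h) (fst α ∷ snd α ∷ xs)
valid-fst-snd FD v = stepF (stepD v)
valid-fst-snd DF v = stepD (stepF v)

tilingPath-valid : ∀ α {m} (t : Tiling m) → Valid (dominoes t) (tilingPath α t)
tilingPath-valid α ∅          = nil
tilingPath-valid α (mono t)   = stepF (tilingPath-valid α t)
tilingPath-valid α (domino t) = valid-fst-snd α (tilingPath-valid α t)

rise : ℕ → Step
rise zero    = F
rise (suc h) = U h

rise-valid : ∀ {h xs} → Valid h xs → Valid 0 (rise h ∷ xs)
rise-valid {zero}  v = stepF v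
rise-valid {suc h} v = stepU h v

¬occursAt-rise-F : ∀ α h → ¬ OccursAt α (rise h ∷ F ∷ []) 0
¬occursAt-rise-F FD zero    (_ , ())
¬occursAt-rise-F DF zero    (() , _)
¬occursAt-rise-F FD (suc _) (() , _)
¬occursAt-rise-F DF (suc _) (() , _)

occurrenceWord-tilingPath : ∀ α s {m} (t : Tiling m) → ¬ OccursAt α (s ∷ F ∷ []) 0 →
  occurrenceWord α (s ∷ tilingPath α t) ≡ false ∷ tilingWord t
occurrenceWord-tilingPath α s ∅ _ =
  cong (_∷ []) (dec-false (occursAt? α (s ∷ []) 0) λ { (_ , ()) })
occurrenceWord-tilingPath α s (mono t) ¬sF =
  cong₂ _∷_ (dec-false (occursAt? α (s ∷ F ∷ tilingPath α t) 0) ¬sF)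
            (occurrenceWord-tilingPath α F t (¬occursAt-rise-F α 0))
occurrenceWord-tilingPath α s (domino t) _ =
  cong₂ _∷_ (dec-false (occursAt? α xs 0) (λ o → occursAt⇒¬occursAt-suc α xs 0 o (refl , refl)))
            (cong₂ _∷_ (dec-true (occursAt? α (fst α ∷ snd α ∷ tilingPath α t) 0) (refl , refl))
                       (occurrenceWord-tilingPath α (snd α) t ¬sndF))
  where
  xs : List Step
  xs = s ∷ fst α ∷ snd α ∷ tilingPath α t
  ¬sndF : ¬ OccursAt α (snd α ∷ F ∷ []) 0
  ¬sndF = occursAt⇒¬occursAt-suc α (fst α ∷ snd α ∷ F ∷ []) 0 (refl , refl)

-- The occurrence words of Łukasiewicz paths of length n: empty for n = 0, and otherwise
-- a 0 (no occurrence at the first step) followed by a tiling word of length n - 1.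
Profile : ℕ → Set
Profile zero    = ⊤
Profile (suc m) = Tiling m

Profile↔Fin : ∀ n → Profile n ↔ Fin (f n)
Profile↔Fin zero    = ↔-sym 1↔⊤
Profile↔Fin (suc m) = Tiling↔Fin m

profileWord : ∀ n → Profile n → List Bool
profileWord zero    _ = []
profileWord (suc m) t = false ∷ tilingWord t

profileWord-injective : ∀ n {s t : Profile n} → profileWord n s ≡ profileWord n t → s ≡ t
profileWord-injective zero    _  = refl
profileWord-injective (suc m) eq = tilingWord-injective (∷-injectiveʳ eq)

profile : Pattern → ∀ {n} → LukPath n → Profile n
profile α ([] , refl , _)     = tt
profile α (_ ∷ xs , refl , _) = proj₁ (occurrenceWord-tiling α xs)

profileWord-profile : ∀ α {n} (p : LukPath n) → profileWord n (profile α p) ≡ occurrenceWord α (proj₁ p)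
profileWord-profile α ([] , refl , _)     = refl
profileWord-profile α (x ∷ xs , refl , v) =
  cong₂ _∷_ (sym (dec-false (occursAt? α (x ∷ xs) 0) (¬occursAt-start α v)))
            (sym (proj₂ (occurrenceWord-tiling α xs)))

realise : Pattern → ∀ n → Profile n → LukPath n
realise α zero    _ = [] , refl , nil
realise α (suc m) t =
  rise (dominoes t) ∷ tilingPath α t , cong suc (length-tilingPath α t) , rise-valid (tilingPath-valid α t)

profile-realise : ∀ α n (s : Profile n) → profile α (realise α n s) ≡ s
profile-realise α zero    _ = refl
profile-realise α (suc m) t = profileWord-injective (suc m) (begin
  profileWord (suc m) (profile α (realise α (suc m) t)) ≡⟨ profileWord-profile α (realise α (suc m) t) ⟩
  occurrenceWord α (rise (dominoes t) ∷ tilingPath α t)  ≡⟨ occurrenceWord-tilingPath α _ t (¬occursAt-rise-F α (dominoes t)) ⟩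
  profileWord (suc m) t                                   ∎)
  where open ≡-Reasoning

profile≡⇔≈ : ∀ α {n} (p q : LukPath n) → (profile α p ≡ profile α q) ⇔ (p ≈[ α ] q)
profile≡⇔≈ α {n} p@(xs , |xs| , _) q@(ys , |ys| , _) =
  occurrenceWord≡⇔ α xs ys (trans |xs| (sym |ys|)) ⇔-∘ mk⇔ to from
  where
  open ≡-Reasoning
  to : profile α p ≡ profile α q → occurrenceWord α xs ≡ occurrenceWord α ys
  to eq = begin
    occurrenceWord α xs       ≡⟨ profileWord-profile α p ⟨
    profileWord n (profile α p) ≡⟨ cong (profileWord n) eq ⟩
    profileWord n (profile α q) ≡⟨ profileWord-profile α q ⟩
    occurrenceWord α ys       ∎
  from : occurrenceWord α xs ≡ occurrenceWord α ys → profile α p ≡ profile α q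
  from eq = profileWord-injective n (begin
    profileWord n (profile α p) ≡⟨ profileWord-profile α p ⟩
    occurrenceWord α xs       ≡⟨ eq ⟩
    occurrenceWord α ys       ≡⟨ profileWord-profile α q ⟨
    profileWord n (profile α q) ∎)

theorem4 : (α : Pattern) (n : ℕ) →
    Σ (LukPath n → Fin (f n)) (λ c →
      ((k : Fin (f n)) → ∃ (λ p → c p ≡ k)) ×
      ((p q : LukPath n) → (c p ≡ c q) ⇔ (p ≈[ α ] q)))
theorem4 α n = classify , surjective , classify≡⇔≈
  where
  open Inverse (Profile↔Fin n) using (to; from; strictlyInverseˡ)

  classify : LukPath n → Fin (f n)
  classify = to ∘ profile α

  surjective : (k : Fin (f n)) → ∃ (λ p → classify p ≡ k)
  surjective k = realise α n (from k) , trans (cong to (profile-realise α n (from k))) (strictlyInverseˡ k)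

  classify≡⇔≈ : (p q : LukPath n) → (classify p ≡ classify q) ⇔ (p ≈[ α ] q)
  classify≡⇔≈ p q = profile≡⇔≈ α p q ⇔-∘ mk⇔ (Injection.injective (↔⇒↣ (Profile↔Fin n))) (cong to)
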